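{- An alphabet $A$ is expressive if and only if $A$ contains at least two distinct words.
   Context: Work in a two-sorted first-order theory with equality whose sorts are words (lower-case variables) and systems (upper-case variables), with two word constants $0$ and $1$, a binary concatenation operation on words written by juxtaposition, and a membership relation $x\in S$ between a word and a system. Axioms: (symbols) $0\neq 1$ and $xy\neq 0$, $xy\neq 1$ for all words $x,y$; (associativity) $(xy)z=x(yz)$; (reading) $x0\neq y1$ for all $x,y$; (simplification) if $x_1y_1=x_2y_2$ and $y_1=y_2$ then $x_1=x_2$; (extensionality) two systems with the same elements are equal; (word induction) every system containing $0$ and $1$ and containing $x0$ and $x1$ whenever it contains $x$ contains every word; (comprehension) for every formula $\phi(x,x_1,\dots,x_n,S_1,\dots,S_m)$ in which $S$ is not free, there is a system $S$ with $x\in S\Leftrightarrow\phi$ for all words $x$. A system $A$ is an alphabet if for all words $x,y$ and all $z_1,z_2\in A$, $xz_1=yz_2$ implies $z_1=z_2$, and $z_1x=z_2y$ implies $z_1=z_2$. The system right-generated by $A$ is the smallest system containing every element of $A$ and containing $x_2x_1$ whenever $x_1\in A$ and $x_2$ belongs to it. Alphabets $A_1,A_2$ are independent if $A_1\cup A_2$ is an alphabet and $A_1\cap A_2=\emptyset$. A non-empty alphabet $A$ is expressive if, with $S$ the system right-generated by $A$, there exist independent alphabets $B_1,B_2$ with $B_1\subseteq S$ and $B_2\subseteq S$. -}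

module Defs where

open import Data.Nat using (ℕ; suc)
open import Data.Fin using (Fin; zero; suc)
open import Data.Product using (Σ; ∃; _×_; _,_)
open import Data.Sum using (_⊎_)
open import Data.Empty using (⊥)
open import Relation.Nullary using (¬_)
open import Relation.Binary.PropositionalEquality using (_≡_; _≢_)

-- Syntax of the two-sorted first-order language
-- (word variables: de Bruijn indices in Fin n; system variables: Fin m)

infixl 7 _·ₜ_

data Term (n : ℕ) : Set where
  var  : Fin n → Term n
  𝟘ₜ   : Term n
  𝟙ₜ   : Term n
  _·ₜ_ : Term n → Term n → Term n

data Formula (n m : ℕ) : Set where
  _≐_   : Term n → Term n → Formula n m
  _≗_   : Fin m → Fin m → Formula n m
  _∈ₜ_  : Term n → Fin m → Formula n m
  ⊥ₜ    : Formula n m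
  _⇒_   : Formula n m → Formula n m → Formula n m
  _∧ₜ_  : Formula n m → Formula n m → Formula n m
  _∨ₜ_  : Formula n m → Formula n m → Formula n m
  ∀w    : Formula (suc n) m → Formula n m
  ∃w    : Formula (suc n) m → Formula n m
  ∀s    : Formula n (suc m) → Formula n m
  ∃s    : Formula n (suc m) → Formula n m

_∷ₑ_ : ∀ {n} {X : Set} → X → (Fin n → X) → Fin (suc n) → X
(x ∷ₑ ρ) zero    = x
(x ∷ₑ ρ) (suc i) = ρ i

record Structure : Set₁ where
  infixl 7 _·_
  infix 4 _∈_
  field
    Word   : Set
    System : Set
    𝟘 𝟙    : Word
    _·_    : Word → Word → Word
    _∈_    : Word → System → Set

  ⟦_⟧t : ∀ {n} → Term n → (Fin n → Word) → Word
  ⟦ var i ⟧t ρ    = ρ i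
  ⟦ 𝟘ₜ ⟧t ρ       = 𝟘
  ⟦ 𝟙ₜ ⟧t ρ       = 𝟙
  ⟦ s ·ₜ t ⟧t ρ   = ⟦ s ⟧t ρ · ⟦ t ⟧t ρ

  ⟦_⟧ : ∀ {n m} → Formula n m → (Fin n → Word) → (Fin m → System) → Set
  ⟦ s ≐ t ⟧ ρ σ   = ⟦ s ⟧t ρ ≡ ⟦ t ⟧t ρ
  ⟦ i ≗ j ⟧ ρ σ   = σ i ≡ σ j
  ⟦ t ∈ₜ i ⟧ ρ σ  = ⟦ t ⟧t ρ ∈ σ i
  ⟦ ⊥ₜ ⟧ ρ σ      = ⊥
  ⟦ φ ⇒ ψ ⟧ ρ σ   = ⟦ φ ⟧ ρ σ → ⟦ ψ ⟧ ρ σ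
  ⟦ φ ∧ₜ ψ ⟧ ρ σ  = ⟦ φ ⟧ ρ σ × ⟦ ψ ⟧ ρ σ
  ⟦ φ ∨ₜ ψ ⟧ ρ σ  = ⟦ φ ⟧ ρ σ ⊎ ⟦ ψ ⟧ ρ σ
  ⟦ ∀w φ ⟧ ρ σ    = (x : Word) → ⟦ φ ⟧ (x ∷ₑ ρ) σ
  ⟦ ∃w φ ⟧ ρ σ    = Σ Word λ x → ⟦ φ ⟧ (x ∷ₑ ρ) σ
  ⟦ ∀s φ ⟧ ρ σ    = (S : System) → ⟦ φ ⟧ ρ (S ∷ₑ σ)
  ⟦ ∃s φ ⟧ ρ σ    = Σ System λ S → ⟦ φ ⟧ ρ (S ∷ₑ σ)

record IsModel (M : Structure) : Set₁ where
  open Structure M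
  field
    𝟘≢𝟙          : 𝟘 ≢ 𝟙
    ·≢𝟘          : ∀ x y → x · y ≢ 𝟘
    ·≢𝟙          : ∀ x y → x · y ≢ 𝟙
    assoc        : ∀ x y z → (x · y) · z ≡ x · (y · z)
    reading      : ∀ x y → x · 𝟘 ≢ y · 𝟙
    simplification : ∀ x₁ y₁ x₂ y₂ → x₁ · y₁ ≡ x₂ · y₂ → y₁ ≡ y₂ → x₁ ≡ x₂
    extensionality : ∀ S T → (∀ x → x ∈ S → x ∈ T) → (∀ x → x ∈ T → x ∈ S) → S ≡ T
    induction    : ∀ S → 𝟘 ∈ S → 𝟙 ∈ S
                   → (∀ x → x ∈ S → x · 𝟘 ∈ S) → (∀ x → x ∈ S → x · 𝟙 ∈ S)
                   → ∀ x → x ∈ S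
    -- comprehension schema: φ has free word variables x (index 0), x₁..xₙ
    -- and free system variables S₁..Sₘ; S is not among them.
    comprehension : ∀ {n m} (φ : Formula (suc n) m)
                    (ρ : Fin n → Word) (σ : Fin m → System)
                    → Σ System λ S → ∀ x →
                        (x ∈ S → ⟦ φ ⟧ (x ∷ₑ ρ) σ) × (⟦ φ ⟧ (x ∷ₑ ρ) σ → x ∈ S)

module Notions (M : Structure) where
  open Structure M

  IsAlphabetP : (Word → Set) → Set
  IsAlphabetP P = ∀ x y z₁ z₂ → P z₁ → P z₂ →
                  (x · z₁ ≡ y · z₂ → z₁ ≡ z₂) × (z₁ · x ≡ z₂ · y → z₁ ≡ z₂)

  IsAlphabet : System → Set
  IsAlphabet A = IsAlphabetP (λ z → z ∈ A)

  RightGenerated : System → System → Set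
  RightGenerated A S =
    (∀ x → x ∈ A → x ∈ S) ×
    (∀ x₁ x₂ → x₁ ∈ A → x₂ ∈ S → x₂ · x₁ ∈ S) ×
    (∀ T → (∀ x → x ∈ A → x ∈ T)
         → (∀ x₁ x₂ → x₁ ∈ A → x₂ ∈ T → x₂ · x₁ ∈ T)
         → ∀ x → x ∈ S → x ∈ T)

  Independent : System → System → Set
  Independent A₁ A₂ =
    IsAlphabet A₁ × IsAlphabet A₂ ×
    IsAlphabetP (λ z → z ∈ A₁ ⊎ z ∈ A₂) ×
    (∀ x → x ∈ A₁ → x ∈ A₂ → ⊥)

  NonEmpty : System → Set
  NonEmpty A = Σ Word λ x → x ∈ A

  _⊆_ : System → System → Set
  B ⊆ S = ∀ x → x ∈ B → x ∈ S

  -- READING: the independent alphabets B₁, B₂ are required to be non-empty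
  -- (otherwise B₁ = B₂ = ∅ would make every non-empty alphabet expressive).
  Expressive : System → Set
  Expressive A =
    NonEmpty A ×
    Σ System λ S → RightGenerated A S ×
      Σ System λ B₁ → Σ System λ B₂ →
        NonEmpty B₁ × NonEmpty B₂ × Independent B₁ B₂ × B₁ ⊆ S × B₂ ⊆ S

-- (⇐) If a ≠ b both lie in A, the singletons {a} and {b} (obtained by
--     comprehension) are independent: their union is a sub-collection of
--     the alphabet A, and they are disjoint.  Both lie in A, hence in the
--     system right-generated by A, which exists by comprehension.
-- (⇒) Classically, otherwise A = {a}.  The key fact is that the centralizer
--     of a word u contains the system S right-generated by A as soon as it
--     contains A (induction over S, applied to a definable property); using
--     it twice shows that S = {a, aa, aaa, …} is commutative.  But in an
--     alphabet two commuting letters are equal, so two non-empty independent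
--     alphabets inside S would share a letter, contradicting disjointness.

module Submission where

open import Defs
open import Level using (0ℓ)
open import Data.Nat using (ℕ)
open import Data.Product using (Σ; _×_; _,_; proj₁; proj₂)
open import Data.Sum using (_⊎_; inj₁; inj₂)
open import Data.Fin using (Fin; zero; suc)
open import Data.Empty using (⊥)
open import Function.Bundles using (_⇔_; mk⇔)
open import Relation.Nullary using (¬_)
open import Relation.Binary.PropositionalEquality
open import Axiom.ExcludedMiddle using (ExcludedMiddle)
open import Axiom.DoubleNegationElimination using (em⇒dne)

module AlphabetFacts (M : Structure) where
  open Structure M
  open Notions M

  alphabet-mono : {P Q : Word → Set} → (∀ z → P z → Q z) →
                  IsAlphabetP Q → IsAlphabetP P
  alphabet-mono P⊆Q alphQ x y z₁ z₂ p₁ p₂ = alphQ x y z₁ z₂ (P⊆Q z₁ p₁) (P⊆Q z₂ p₂)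

  -- Two letters of an alphabet that commute are equal
  -- (read z₂z₁ = z₁z₂ from the right: the last letters must agree).
  commuting-letters-equal : {P : Word → Set} → IsAlphabetP P →
                            ∀ {z₁ z₂} → P z₁ → P z₂ → z₁ · z₂ ≡ z₂ · z₁ → z₁ ≡ z₂
  commuting-letters-equal alph {z₁} {z₂} p₁ p₂ comm =
    proj₁ (alph z₂ z₁ z₁ z₂ p₁ p₂) (sym comm)

module ModelFacts (M : Structure) (IM : IsModel M) where
  open Structure M
  open IsModel IM
  open Notions M

  noWords : Fin 0 → Word
  noWords ()

  -- "x is the word w" (x is word variable 0, w is word parameter 1).
  singletonFormula : Formula 2 0
  singletonFormula = var zero ≐ var (suc zero)

  singleton : (w : Word) → Σ System λ B → ∀ x → (x ∈ B → x ≡ w) × (x ≡ w → x ∈ B)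
  singleton w = comprehension singletonFormula (λ _ → w) (λ ())

  -- "x lies in every system T containing A and closed under right
  -- multiplication by letters of A"; system 0 is T, system 1 is A.
  generatedFormula : Formula 1 1
  generatedFormula =
    ∀s ((∀w ((var zero ∈ₜ suc zero) ⇒ (var zero ∈ₜ zero))) ⇒
        ((∀w (∀w ((var (suc zero) ∈ₜ suc zero) ⇒
                 ((var zero ∈ₜ zero) ⇒ ((var zero ·ₜ var (suc zero)) ∈ₜ zero))))) ⇒
         (var zero ∈ₜ zero)))

  rightGenerated-exists : (A : System) → Σ System (RightGenerated A)
  rightGenerated-exists A with comprehension generatedFormula noWords (λ _ → A)
  ... | S , S≡ = S , base , step , least
    where
      base : ∀ x → x ∈ A → x ∈ S
      base x xA = proj₂ (S≡ x) (λ T A⊆T closed → A⊆T x xA)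
      step : ∀ x₁ x₂ → x₁ ∈ A → x₂ ∈ S → x₂ · x₁ ∈ S
      step x₁ x₂ x₁A x₂S =
        proj₂ (S≡ (x₂ · x₁)) (λ T A⊆T closed → closed x₁ x₂ x₁A (proj₁ (S≡ x₂) x₂S T A⊆T closed))
      least : ∀ T → (∀ x → x ∈ A → x ∈ T) → (∀ x₁ x₂ → x₁ ∈ A → x₂ ∈ T → x₂ · x₁ ∈ T)
            → ∀ x → x ∈ S → x ∈ T
      least T A⊆T closed x xS = proj₁ (S≡ x) xS T A⊆T closed

  -- Induction along right-generation, for any property definable by a
  -- formula φ (with parameters ρ, σ): minimality applied to the system
  -- that comprehension builds from φ.
  rightGenerated-induction :
    ∀ {A S n m} → RightGenerated A S →
    (φ : Formula (ℕ.suc n) m) (ρ : Fin n → Word) (σ : Fin m → System) →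
    (∀ x → x ∈ A → ⟦ φ ⟧ (x ∷ₑ ρ) σ) →
    (∀ x₁ x₂ → x₁ ∈ A → ⟦ φ ⟧ (x₂ ∷ₑ ρ) σ → ⟦ φ ⟧ ((x₂ · x₁) ∷ₑ ρ) σ) →
    ∀ x → x ∈ S → ⟦ φ ⟧ (x ∷ₑ ρ) σ
  rightGenerated-induction (_ , _ , least) φ ρ σ base step x xS
    with comprehension φ ρ σ
  ... | T , T≡ = proj₁ (T≡ x) (least T
        (λ y yA → proj₂ (T≡ y) (base y yA))
        (λ y₁ y₂ y₁A y₂T → proj₂ (T≡ (y₂ · y₁)) (step y₁ y₂ y₁A (proj₁ (T≡ y₂) y₂T)))
        x xS)

  Commute : Word → Word → Set
  Commute x u = x · u ≡ u · x

  commute-· : ∀ {x y u} → Commute x u → Commute y u → Commute (x · y) u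
  commute-· {x} {y} {u} xu yu = begin
    (x · y) · u  ≡⟨ assoc x y u ⟩
    x · (y · u)  ≡⟨ cong (x ·_) yu ⟩
    x · (u · y)  ≡⟨ sym (assoc x u y) ⟩
    (x · u) · y  ≡⟨ cong (_· y) xu ⟩
    (u · x) · y  ≡⟨ assoc u x y ⟩
    u · (x · y)  ∎
    where open ≡-Reasoning

  -- "x commutes with the word u" (x is word variable 0, u is parameter 1).
  commuteFormula : Formula 2 0
  commuteFormula = (var zero ·ₜ var (suc zero)) ≐ (var (suc zero) ·ₜ var zero)

  centralizer-contains-generated :
    ∀ {A S} → RightGenerated A S → ∀ u →
    (∀ z → z ∈ A → Commute z u) → ∀ x → x ∈ S → Commute x u
  centralizer-contains-generated rg u A-comm =
    rightGenerated-induction rg commuteFormula (λ _ → u) (λ ())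
      A-comm (λ x₁ x₂ x₁A x₂u → commute-· x₂u (A-comm x₁ x₁A))

  generated-by-one-letter-commutative :
    ∀ {A S a} → RightGenerated A S → (∀ z → z ∈ A → z ≡ a) →
    ∀ x y → x ∈ S → y ∈ S → Commute x y
  generated-by-one-letter-commutative {A} {S} {a} rg only-a x y xS yS =
    centralizer-contains-generated rg y A-comm-y x xS
    where
      S-comm-a : ∀ v → v ∈ S → Commute v a
      S-comm-a = centralizer-contains-generated rg a
        (λ z zA → subst (λ w → Commute w a) (sym (only-a z zA)) refl)

      A-comm-y : ∀ z → z ∈ A → Commute z y
      A-comm-y z zA = subst (λ w → Commute w y) (sym (only-a z zA)) (sym (S-comm-a y yS))

module Theorem (M : Structure) (IM : IsModel M)
               (A : Structure.System M) (alph : Notions.IsAlphabet M A) where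
  open Structure M
  open Notions M
  open AlphabetFacts M
  open ModelFacts M IM

  TwoLetters : Set
  TwoLetters = Σ Word λ x → Σ Word λ y → x ∈ A × y ∈ A × x ≢ y

  expressive-from-two-letters : TwoLetters → Expressive A
  expressive-from-two-letters (a , b , aA , bA , a≢b)
    with rightGenerated-exists A | singleton a | singleton b
  ... | S , rg | B₁ , B₁≡ | B₂ , B₂≡ =
    (a , aA) , S , rg , B₁ , B₂ ,
    (a , proj₂ (B₁≡ a) refl) , (b , proj₂ (B₂≡ b) refl) ,
    (alphabet-mono B₁⊆A alph , alphabet-mono B₂⊆A alph ,
     alphabet-mono B₁∪B₂⊆A alph , disjoint) ,
    (λ x xB₁ → base x (B₁⊆A x xB₁)) , (λ x xB₂ → base x (B₂⊆A x xB₂))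
    where
      base : ∀ x → x ∈ A → x ∈ S
      base = proj₁ rg
      B₁⊆A : ∀ z → z ∈ B₁ → z ∈ A
      B₁⊆A z zB₁ = subst (_∈ A) (sym (proj₁ (B₁≡ z) zB₁)) aA
      B₂⊆A : ∀ z → z ∈ B₂ → z ∈ A
      B₂⊆A z zB₂ = subst (_∈ A) (sym (proj₁ (B₂≡ z) zB₂)) bA
      B₁∪B₂⊆A : ∀ z → z ∈ B₁ ⊎ z ∈ B₂ → z ∈ A
      B₁∪B₂⊆A z (inj₁ zB₁) = B₁⊆A z zB₁
      B₁∪B₂⊆A z (inj₂ zB₂) = B₂⊆A z zB₂
      disjoint : ∀ x → x ∈ B₁ → x ∈ B₂ → ⊥
      disjoint x xB₁ xB₂ = a≢b (trans (sym (proj₁ (B₁≡ x) xB₁)) (proj₁ (B₂≡ x) xB₂))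

  -- If A has only the letter a, its generated system is commutative, so
  -- letters b₁ ∈ B₁, b₂ ∈ B₂ commute and are equal, against B₁ ∩ B₂ = ∅.
  not-expressive-with-one-letter : ∀ a → (∀ z → z ∈ A → z ≡ a) → ¬ Expressive A
  not-expressive-with-one-letter a only-a
    (_ , S , rg , B₁ , B₂ , (b₁ , b₁B₁) , (b₂ , b₂B₂) , (_ , _ , alph₁₂ , disjoint) , B₁⊆S , B₂⊆S) =
    disjoint b₁ b₁B₁ (subst (_∈ B₂) (sym b₁≡b₂) b₂B₂)
    where
      b₁≡b₂ : b₁ ≡ b₂
      b₁≡b₂ = commuting-letters-equal alph₁₂ (inj₁ b₁B₁) (inj₂ b₂B₂)
        (generated-by-one-letter-commutative rg only-a b₁ b₂ (B₁⊆S b₁ b₁B₁) (B₂⊆S b₂ b₂B₂))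

  two-letters-from-expressive : ExcludedMiddle 0ℓ → Expressive A → TwoLetters
  two-letters-from-expressive em expr@((a , aA) , _) = dne λ ¬two →
    not-expressive-with-one-letter a
      (λ z zA → dne λ z≢a → ¬two (z , a , zA , aA , z≢a)) expr
    where dne = em⇒dne em

mainTheorem19 : ExcludedMiddle 0ℓ → (M : Structure) → IsModel M →
    (A : Structure.System M) → Notions.IsAlphabet M A →
    Notions.Expressive M A ⇔
      (Σ (Structure.Word M) λ x → Σ (Structure.Word M) λ y →
        Structure._∈_ M x A × Structure._∈_ M y A × x ≢ y)
mainTheorem19 em M IM A alph =
  mk⇔ (two-letters-from-expressive em) expressive-from-two-letters
  where open Theorem M IM A alph
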